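{- (a) Let $(K_2,\sigma)$ be a signed edge with vertices $u,v$, and let $f(u),f(v)\ge 1$ be integers with $f(u)+f(v)\ge 7$. Then $(K_2,\sigma)$ is $f$-list-colorable. (b) Let $(P_3,\sigma)$ be a signed path $v_1v_2v_3$, and let $f$ be such that $f(v_i)\ge1$ for $i=1,2,3$, $f(v_i)+f(v_{i+1})\ge 7$ for $i=1,2$, and $f(v_1)+f(v_2)+f(v_3)\ge 13$. Then $(P_3,\sigma)$ is $f$-list-colorable.
   Context: Colors are the vertices of $K^s_{10;3}$, written $\pm[5]=\{\pm1,\dots,\pm5\}$ in the cyclic order $1,2,3,4,5,-1,-2,-3,-4,-5$; two colors are joined by a positive edge iff their cyclic distance is at most $2$ (including equal colors) and by a negative edge iff their cyclic distance is at least $3$. Given a signed graph and a list assignment $\mathcal L=\{L(v)\}$ with $L(v)\subseteq\pm[5]$, an $\mathcal L$-coloring is a map $\phi$ with $\phi(v)\in L(v)$ such that for every edge $xy$ of sign $s$, $\phi(x)\phi(y)$ is an edge of $K^s_{10;3}$ of sign $s$. For $f:V\to\mathbb{Z}_{\ge 0}$, the signed graph is $f$-list-colorable if it is $\mathcal L$-colorable for every list assignment with $|L(v)|=f(v)$ for all $v$. -}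

module Defs where

open import Data.Nat using (ℕ; _≤_; _∸_; _⊓_; ∣_-_∣)
open import Data.Fin using (Fin; toℕ)
open import Data.Fin.Subset using (Subset; _∈_; ∣_∣)
open import Data.List using (List; []; _∷_)
open import Data.List.Relation.Unary.All using (All)
open import Data.Product using (_×_; _,_; Σ)
open import Relation.Binary.PropositionalEquality using (_≡_)

-- Colors ±[5] : encoded as Fin 10, position i in the cyclic order
-- 1,2,3,4,5,-1,-2,-3,-4,-5  (so i ↦ i+1 for i<5, and i ↦ -(i-4) for i≥5).
Color : Set
Color = Fin 10

data Sign : Set where
  pos neg : Sign

cycDist : Color → Color → ℕ
cycDist a b = ∣ toℕ a - toℕ b ∣ ⊓ (10 ∸ ∣ toℕ a - toℕ b ∣)

KEdge : Sign → Color → Color → Set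
KEdge pos a b = cycDist a b ≤ 2
KEdge neg a b = 3 ≤ cycDist a b

record SignedGraph (n : ℕ) : Set where
  constructor mkSG
  field
    edges : List (Fin n × Fin n × Sign)
open SignedGraph public

ListAssignment : ℕ → Set
ListAssignment n = Fin n → Subset 10

RespectsEdge : {n : ℕ} → (Fin n → Color) → Fin n × Fin n × Sign → Set
RespectsEdge φ (x , y , s) = KEdge s (φ x) (φ y)

LColoring : {n : ℕ} → SignedGraph n → ListAssignment n → (Fin n → Color) → Set
LColoring G L φ = (∀ v → φ v ∈ L v) × All (RespectsEdge φ) (edges G)

LColorable : {n : ℕ} → SignedGraph n → ListAssignment n → Set
LColorable G L = Σ (Fin _ → Color) (LColoring G L)

FListColorable : {n : ℕ} → SignedGraph n → (Fin n → ℕ) → Set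
FListColorable G f = (L : ListAssignment _) → (∀ v → ∣ L v ∣ ≡ f v) → LColorable G L

-- signed edge K2 on vertices u = 0, v = 1 with sign σ
signedK2 : Sign → SignedGraph 2
signedK2 σ = mkSG ((Fin.zero , Fin.suc Fin.zero , σ) ∷ [])

-- signed path v1 v2 v3 (vertices 0,1,2) with edge signs σ₁ (v1v2), σ₂ (v2v3)
signedP3 : Sign → Sign → SignedGraph 3
signedP3 σ₁ σ₂ = mkSG ((Fin.zero , Fin.suc Fin.zero , σ₁)
                     ∷ (Fin.suc Fin.zero , Fin.suc (Fin.suc Fin.zero) , σ₂) ∷ [])

-- In K_{10;3} the positive (resp. negative) neighbourhood of a colour set A is
-- A + I for an interval I of five residues mod 10, so unless it is everything it
-- has at least ∣ A ∣ + 4 elements: a nonempty A leaves at most 6 − ∣ A ∣ colours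
-- with no neighbour in A. If the edge uv admits no colouring, all of L(v) is such
-- a colour for A = L(u), forcing f(u) + f(v) ≤ 6. If the path v₁v₂v₃ admits none,
-- every colour of L(v₂) misses L(v₁) or L(v₃); the two bounds then give
-- f(v₁) + f(v₂) ≤ 6, f(v₂) + f(v₃) ≤ 6 or f(v₁) + f(v₂) + f(v₃) ≤ 12.
module Submission where

open import Defs
open import Data.Nat using (ℕ; zero; suc; _≤_; _<_; _+_; _⊓_; _∸_; _≤?_; _<?_; z≤n; s≤s)
open import Data.Nat.Properties
  using (≤-trans; <⇒≱; +-monoʳ-≤; +-monoˡ-≤; +-mono-≤; +-comm; +-suc; +-identityʳ; ∣-∣-comm; module ≤-Reasoning)
open import Data.Nat.Tactic.RingSolver using (solve-∀)
open import Data.Fin using (Fin; zero; suc; toℕ)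
open import Data.Fin.Properties using (any?)
open import Data.Fin.Subset using (Subset; _∈_; _⊆_; _∪_; ∣_∣; inside; outside)
open import Data.Fin.Subset.Properties
  using (_∈?_; anySubset?; p⊆q⇒∣p∣≤∣q∣; ∣p∣≤∣x∷p∣; x∈p∪q⁺)
open import Data.Vec using (_∷_; []; tabulate)
open import Data.Vec.Properties using (lookup∘tabulate; lookup⇒[]=)
open import Data.Sum using (_⊎_; inj₁; inj₂)
open import Data.Product using (_×_; _,_; ∃-syntax)
open import Data.List.Relation.Unary.All using ([]; _∷_)
open import Function using (_∘_)
open import Level using (Level)
open import Relation.Nullary using (Dec; yes; no; does; ¬?; _×-dec_; _→-dec_; contradiction)
open import Relation.Nullary.Decidable using (toWitness; decidable-stable)
open import Relation.Unary using (Pred; Decidable)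
open import Relation.Binary.PropositionalEquality using (_≡_; refl; sym; trans; cong; subst)

private
  variable
    ℓ : Level
    n : ℕ

allSubsets? : {P : Pred (Subset n) ℓ} → Decidable P → Dec (∀ p → P p)
allSubsets? P? with anySubset? (¬? ∘ P?)
... | yes (p , ¬Pp) = no λ ∀P → ¬Pp (∀P p)
... | no ∄¬P = yes λ p → decidable-stable (P? p) λ ¬Pp → ∄¬P (p , ¬Pp)

filterFin : {P : Pred (Fin n) ℓ} → Decidable P → Subset n
filterFin P? = tabulate (does ∘ P?)

∈-filterFin : {P : Pred (Fin n) ℓ} (P? : Decidable P) {x : Fin n} → P x → x ∈ filterFin P?
∈-filterFin P? {x} Px with P? x in eq
... | yes _ = lookup⇒[]= x _ (trans (lookup∘tabulate (does ∘ P?) x) (cong does eq))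
... | no ¬Px = contradiction Px ¬Px

∣p∪q∣≤∣p∣+∣q∣ : (p q : Subset n) → ∣ p ∪ q ∣ ≤ ∣ p ∣ + ∣ q ∣
∣p∪q∣≤∣p∣+∣q∣ [] [] = z≤n
∣p∪q∣≤∣p∣+∣q∣ (inside ∷ p) (y ∷ q) =
  s≤s (≤-trans (∣p∪q∣≤∣p∣+∣q∣ p q) (+-monoʳ-≤ ∣ p ∣ (∣p∣≤∣x∷p∣ y q)))
∣p∪q∣≤∣p∣+∣q∣ (outside ∷ p) (inside ∷ q) =
  subst (suc ∣ p ∪ q ∣ ≤_) (sym (+-suc ∣ p ∣ ∣ q ∣)) (s≤s (∣p∪q∣≤∣p∣+∣q∣ p q))
∣p∪q∣≤∣p∣+∣q∣ (outside ∷ p) (outside ∷ q) = ∣p∪q∣≤∣p∣+∣q∣ p q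

kEdge? : (s : Sign) (a b : Color) → Dec (KEdge s a b)
kEdge? pos a b = cycDist a b ≤? 2
kEdge? neg a b = 3 ≤? cycDist a b

cycDist-comm : (a b : Color) → cycDist a b ≡ cycDist b a
cycDist-comm a b = cong (λ d → d ⊓ (10 ∸ d)) (∣-∣-comm (toℕ a) (toℕ b))

KEdge-sym : (s : Sign) {a b : Color} → KEdge s a b → KEdge s b a
KEdge-sym pos {a} {b} = subst (_≤ 2) (cycDist-comm a b)
KEdge-sym neg {a} {b} = subst (3 ≤_) (cycDist-comm a b)

HasNeighbourIn : Sign → Subset 10 → Color → Set
HasNeighbourIn s A x = ∃[ a ] a ∈ A × KEdge s a x

hasNeighbourIn? : (s : Sign) (A : Subset 10) → Decidable (HasNeighbourIn s A)
hasNeighbourIn? s A x = any? λ a → a ∈? A ×-dec kEdge? s a x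

nonNeighbours : Sign → Subset 10 → Subset 10
nonNeighbours s A = filterFin (¬? ∘ hasNeighbourIn? s A)

NonNeighboursBound : Sign → Subset 10 → Set
NonNeighboursBound s A = 0 < ∣ A ∣ → 0 < ∣ nonNeighbours s A ∣ → ∣ A ∣ + ∣ nonNeighbours s A ∣ ≤ 6

nonNeighboursBound? : (s : Sign) → Decidable (NonNeighboursBound s)
nonNeighboursBound? s A = 0 <? ∣ A ∣ →-dec (0 <? ∣ nonNeighbours s A ∣ →-dec ∣ A ∣ + ∣ nonNeighbours s A ∣ ≤? 6)

nonNeighbours-bound : (s : Sign) (A : Subset 10) → NonNeighboursBound s A
nonNeighbours-bound pos = toWitness {a? = allSubsets? (nonNeighboursBound? pos)} _
nonNeighbours-bound neg = toWitness {a? = allSubsets? (nonNeighboursBound? neg)} _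

signedK2-colorable-or-blocked : (σ : Sign) (L : ListAssignment 2) →
  LColorable (signedK2 σ) L ⊎ L (suc zero) ⊆ nonNeighbours σ (L zero)
signedK2-colorable-or-blocked σ L
  with any? (λ x → x ∈? L (suc zero) ×-dec hasNeighbourIn? σ (L zero) x)
... | yes (x , x∈L₁ , a , a∈L₀ , ax) = inj₁ (φ , ∈L , ax ∷ [])
  where
  φ : Fin 2 → Color
  φ zero = a
  φ (suc zero) = x
  ∈L : ∀ v → φ v ∈ L v
  ∈L zero = a∈L₀
  ∈L (suc zero) = x∈L₁
... | no ∄x = inj₂ λ {x} x∈L₁ →
  ∈-filterFin (¬? ∘ hasNeighbourIn? σ (L zero)) λ hasNb → ∄x (x , x∈L₁ , hasNb)

signedP3-colorable-or-blocked : (σ₁ σ₂ : Sign) (L : ListAssignment 3) →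
  LColorable (signedP3 σ₁ σ₂) L ⊎
  L (suc zero) ⊆ nonNeighbours σ₁ (L zero) ∪ nonNeighbours σ₂ (L (suc (suc zero)))
signedP3-colorable-or-blocked σ₁ σ₂ L
  with any? (λ x → x ∈? L (suc zero) ×-dec
                   (hasNeighbourIn? σ₁ (L zero) x ×-dec hasNeighbourIn? σ₂ (L (suc (suc zero))) x))
... | yes (x , x∈L₁ , (a , a∈L₀ , ax) , (c , c∈L₂ , cx)) = inj₁ (φ , ∈L , ax ∷ KEdge-sym σ₂ cx ∷ [])
  where
  φ : Fin 3 → Color
  φ zero = a
  φ (suc zero) = x
  φ (suc (suc zero)) = c
  ∈L : ∀ v → φ v ∈ L v
  ∈L zero = a∈L₀
  ∈L (suc zero) = x∈L₁
  ∈L (suc (suc zero)) = c∈L₂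
... | no ∄x = inj₂ λ {x} x∈L₁ → x∈p∪q⁺ (blocked x x∈L₁)
  where
  blocked : ∀ x → x ∈ L (suc zero) →
    x ∈ nonNeighbours σ₁ (L zero) ⊎ x ∈ nonNeighbours σ₂ (L (suc (suc zero)))
  blocked x x∈L₁ with hasNeighbourIn? σ₁ (L zero) x
  ... | yes hasNb₀ = inj₂ (∈-filterFin (¬? ∘ hasNeighbourIn? σ₂ (L (suc (suc zero))))
                             λ hasNb₂ → ∄x (x , x∈L₁ , hasNb₀ , hasNb₂))
  ... | no ¬hasNb₀ = inj₁ (∈-filterFin (¬? ∘ hasNeighbourIn? σ₁ (L zero)) ¬hasNb₀)

edge-bound : ∀ {a b p} → 0 < b → b ≤ p → (0 < p → a + p ≤ 6) → a + b ≤ 6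
edge-bound {a} 0<b b≤p bound = ≤-trans (+-monoʳ-≤ a b≤p) (bound (≤-trans 0<b b≤p))

path-bound : ∀ {a b c p q} → 0 < b → b ≤ p + q →
  (0 < p → a + p ≤ 6) → (0 < q → c + q ≤ 6) →
  a + b ≤ 6 ⊎ b + c ≤ 6 ⊎ a + b + c ≤ 12
path-bound {b = b} {c} {zero} 0<b b≤q _ bound₂ =
  inj₂ (inj₁ (subst (_≤ 6) (+-comm c b) (edge-bound 0<b b≤q bound₂)))
path-bound {b = b} {p = p@(suc _)} {zero} 0<b b≤p+0 bound₀ _ =
  inj₁ (edge-bound 0<b (subst (b ≤_) (+-identityʳ p) b≤p+0) bound₀)
path-bound {a} {b} {c} {p@(suc _)} {q@(suc _)} _ b≤p+q bound₀ bound₂ = inj₂ (inj₂ (begin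
  a + b + c         ≤⟨ +-monoˡ-≤ c (+-monoʳ-≤ a b≤p+q) ⟩
  a + (p + q) + c   ≡⟨ regroup a p q c ⟩
  (a + p) + (c + q) ≤⟨ +-mono-≤ (bound₀ (s≤s z≤n)) (bound₂ (s≤s z≤n)) ⟩
  12                ∎))
  where
  open ≤-Reasoning
  regroup : ∀ a p q c → a + (p + q) + c ≡ (a + p) + (c + q)
  regroup = solve-∀

∣A∣≡a⇒a+∣nonNeighbours∣≤6 : (s : Sign) (A : Subset 10) {a : ℕ} → ∣ A ∣ ≡ a →
  0 < a → 0 < ∣ nonNeighbours s A ∣ → a + ∣ nonNeighbours s A ∣ ≤ 6
∣A∣≡a⇒a+∣nonNeighbours∣≤6 s A refl = nonNeighbours-bound s A

∣p∣≡m⇒p⊆q⇒m≤∣q∣ : {p q : Subset n} {m : ℕ} → ∣ p ∣ ≡ m → p ⊆ q → m ≤ ∣ q ∣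
∣p∣≡m⇒p⊆q⇒m≤∣q∣ refl = p⊆q⇒∣p∣≤∣q∣

signedK2-fListColorable : (σ : Sign) (f : Fin 2 → ℕ) →
  1 ≤ f zero → 1 ≤ f (suc zero) → 7 ≤ f zero + f (suc zero) →
  FListColorable (signedK2 σ) f
signedK2-fListColorable σ f 0<f₀ 0<f₁ 7≤f₀+f₁ L ∣L∣≡f
  with signedK2-colorable-or-blocked σ L
... | inj₁ colorable = colorable
... | inj₂ L₁⊆N₀ = contradiction
  (edge-bound 0<f₁ (∣p∣≡m⇒p⊆q⇒m≤∣q∣ (∣L∣≡f (suc zero)) L₁⊆N₀)
     (∣A∣≡a⇒a+∣nonNeighbours∣≤6 σ (L zero) (∣L∣≡f zero) 0<f₀))
  (<⇒≱ 7≤f₀+f₁)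

signedP3-fListColorable : (σ₁ σ₂ : Sign) (f : Fin 3 → ℕ) →
  1 ≤ f zero → 1 ≤ f (suc zero) → 1 ≤ f (suc (suc zero)) →
  7 ≤ f zero + f (suc zero) → 7 ≤ f (suc zero) + f (suc (suc zero)) →
  13 ≤ f zero + f (suc zero) + f (suc (suc zero)) →
  FListColorable (signedP3 σ₁ σ₂) f
signedP3-fListColorable σ₁ σ₂ f 0<f₀ 0<f₁ 0<f₂ 7≤f₀+f₁ 7≤f₁+f₂ 13≤f₀+f₁+f₂ L ∣L∣≡f
  with signedP3-colorable-or-blocked σ₁ σ₂ L
... | inj₁ colorable = colorable
... | inj₂ L₁⊆N₀∪N₂
  with path-bound 0<f₁
         (≤-trans (∣p∣≡m⇒p⊆q⇒m≤∣q∣ (∣L∣≡f (suc zero)) L₁⊆N₀∪N₂)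
                  (∣p∪q∣≤∣p∣+∣q∣ (nonNeighbours σ₁ (L zero)) (nonNeighbours σ₂ (L (suc (suc zero))))))
         (∣A∣≡a⇒a+∣nonNeighbours∣≤6 σ₁ (L zero) (∣L∣≡f zero) 0<f₀)
         (∣A∣≡a⇒a+∣nonNeighbours∣≤6 σ₂ (L (suc (suc zero))) (∣L∣≡f (suc (suc zero))) 0<f₂)
...   | inj₁ f₀+f₁≤6 = contradiction f₀+f₁≤6 (<⇒≱ 7≤f₀+f₁)
...   | inj₂ (inj₁ f₁+f₂≤6) = contradiction f₁+f₂≤6 (<⇒≱ 7≤f₁+f₂)
...   | inj₂ (inj₂ f₀+f₁+f₂≤12) = contradiction f₀+f₁+f₂≤12 (<⇒≱ 13≤f₀+f₁+f₂)

lemma2p9 :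
    ((σ : Sign) (f : Fin 2 → ℕ) →
      1 ≤ f zero → 1 ≤ f (suc zero) → 7 ≤ f zero + f (suc zero) →
      FListColorable (signedK2 σ) f)
    ×
    ((σ₁ σ₂ : Sign) (f : Fin 3 → ℕ) →
      1 ≤ f zero → 1 ≤ f (suc zero) → 1 ≤ f (suc (suc zero)) →
      7 ≤ f zero + f (suc zero) → 7 ≤ f (suc zero) + f (suc (suc zero)) →
      13 ≤ f zero + f (suc zero) + f (suc (suc zero)) →
      FListColorable (signedP3 σ₁ σ₂) f)
lemma2p9 = signedK2-fListColorable , signedP3-fListColorable
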